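{- Let $\mathcal{G}=(\mathcal{A},\mathrm{CostParity}(\Omega,\mathrm{Cst}))$ be a parity game with costs with $n$ vertices. Consider the following algorithm: set $j\leftarrow 0$, $W_0^0\leftarrow\emptyset$, $\mathcal{A}_0\leftarrow\mathcal{A}$; then repeat: $j\leftarrow j+1$; $X_j\leftarrow W_0(\mathcal{A}_{j-1},\mathrm{BndCostParity}(\Omega,\mathrm{Cst}))$ (with $\Omega$ and $\mathrm{Cst}$ restricted to $\mathcal{A}_{j-1}$); $W_0^j\leftarrow W_0^{j-1}\cup\mathrm{Attr}_0^{\mathcal{A}_{j-1}}(X_j)$; $\mathcal{A}_j\leftarrow\mathcal{A}_{j-1}\setminus\mathrm{Attr}_0^{\mathcal{A}_{j-1}}(X_j)$; until $X_j=\emptyset$; finally return $W_0^j$. This algorithm returns $W_0(\mathcal{G})$ after at most $n+1$ iterations.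
   Context: An arena is a tuple $\mathcal{A}=(V,V_0,V_1,E)$ where $(V,E)$ is a finite directed graph in which every vertex has at least one outgoing edge, and $\{V_0,V_1\}$ is a partition of $V$. A play is an infinite path $\rho=\rho_0\rho_1\cdots$ in $(V,E)$. A game $(\mathcal{A},\mathrm{Win})$ has Player $0$ winning the plays in $\mathrm{Win}\subseteq V^\omega$ and Player $1$ the others. A strategy for Player $i$ is a map $\sigma:V^*V_i\to V$ with $(v,\sigma(wv))\in E$; it is winning from $W$ if all plays starting in $W$ consistent with it are won by Player $i$; $W_i(\mathcal{G})$ is the set of vertices from which Player $i$ has a winning strategy. For $F\subseteq V$, the $0$-attractor $\mathrm{Attr}_0^{\mathcal{A}}(F)=\bigcup_{j=0}^{|V|}A_j$ where $A_0=F$ and $A_{j+1}=A_j\cup\{v\in V_0:\exists v'\in A_j,(v,v')\in E\}\cup\{v\in V_1:\forall v', (v,v')\in E\Rightarrow v'\in A_j\}$. For an arena $\mathcal{A}$ and a set $X$ of vertices, $\mathcal{A}\setminus X$ denotes the subarena induced by the remaining vertices (when $X$ is a $0$-attractor, every remaining vertex still has an outgoing edge). A cost function is $\mathrm{Cst}:E\to\{\epsilon,i\}$; edges labelled $i$ are increment-edges; the cost $\mathrm{Cst}(w)\in\mathbb{N}\cup\{\infty\}$ of a path is the number of increment-edges it traverses. A coloring is $\Omega:V\to\mathbb{N}$; $\mathrm{Ans}(c)=\{c'\in\mathbb{N}:c'\ge c,\ c'\text{ even}\}$. For a play $\rho$ and position $k$ let $\mathrm{Cor}(\rho,k)=\min\{\mathrm{Cst}(\rho_k\cdots\rho_{k'}):k'\ge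 k,\ \Omega(\rho_{k'})\in\mathrm{Ans}(\Omega(\rho_k))\}$ ($\min\emptyset=\infty$); the request at $k$ is unanswered with cost $\infty$ if the set is empty and infinitely many increment-edges are traversed after $k$. $\mathrm{CostParity}(\Omega,\mathrm{Cst})=\{\rho:\limsup_{k\to\infty}\mathrm{Cor}(\rho,k)<\infty\}$; $\mathrm{BndCostParity}(\Omega,\mathrm{Cst})$ is the set of plays in $\mathrm{CostParity}(\Omega,\mathrm{Cst})$ containing no request unanswered with cost $\infty$. -}

module Defs where

open import Data.Nat using (ℕ; zero; suc; _+_; _≤_)
open import Data.Nat.Divisibility using (_∣_)
open import Data.Fin using (Fin)
open import Data.Bool using (Bool; true; false; if_then_else_)
open import Data.List using (List; map; upTo)
open import Data.Product using (Σ; ∃; _×_; _,_)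
open import Data.Sum using (_⊎_)
open import Data.Unit using (⊤)
open import Data.Empty using (⊥)
open import Relation.Nullary using (¬_)
open import Relation.Binary.PropositionalEquality using (_≡_)

-- Vertices of an arena with n vertices are Fin n.
-- Players: false = Player 0, true = Player 1.
Player : Set
Player = Bool

record Arena (n : ℕ) : Set where
  field
    E     : Fin n → Fin n → Bool
    owner : Fin n → Player
    total : ∀ v → ∃ λ v' → E v v' ≡ true

-- A parity game with costs: arena, coloring Ω, cost function Cst
-- (Cst v v' ≡ true means the edge (v,v') is an increment-edge i,
--  false means ε; values on non-edges are irrelevant).
record CostParityGame (n : ℕ) : Set₁ where
  field
    arena : Arena n
    Ω     : Fin n → ℕ
    Cst   : Fin n → Fin n → Bool
  open Arena arena public

-- Sets of vertices are predicates; subarenas are given by their vertex set.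
VSet : ℕ → Set₁
VSet n = Fin n → Set

Play : ℕ → Set
Play n = ℕ → Fin n

module _ {n : ℕ} (G : CostParityGame n) where
  open CostParityGame G

  all : VSet n
  all _ = ⊤

  _∖_ : VSet n → VSet n → VSet n
  (S ∖ X) v = S v × ¬ X v

  _∪_ : VSet n → VSet n → VSet n
  (X ∪ Y) v = X v ⊎ Y v

  ∅ : VSet n
  ∅ _ = ⊥

  IsPlayIn : VSet n → Play n → Set
  IsPlayIn S ρ = (∀ k → S (ρ k)) × (∀ k → E (ρ k) (ρ (suc k)) ≡ true)

  -- history ρ₀ ⋯ ρ_{k-1} (the current vertex ρ_k is passed separately)
  hist : Play n → ℕ → List (Fin n)
  hist ρ k = map ρ (upTo k)

  -- A strategy for player i in the subarena induced by S: σ w v = σ(wv).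
  Strategy : VSet n → Player → Set
  Strategy S i = Σ (List (Fin n) → Fin n → Fin n) λ σ →
    ∀ w v → S v → owner v ≡ i → S (σ w v) × E v (σ w v) ≡ true

  Consistent : {S : VSet n} {i : Player} → Strategy S i → Play n → Set
  Consistent {i = i} (σ , _) ρ = ∀ k → owner (ρ k) ≡ i → ρ (suc k) ≡ σ (hist ρ k) (ρ k)

  W₀ : VSet n → (Play n → Set) → VSet n
  W₀ S Win v = S v × Σ (Strategy S false) λ σ →
    ∀ ρ → IsPlayIn S ρ → ρ 0 ≡ v → Consistent σ ρ → Win ρ

  attrStep : VSet n → VSet n → VSet n
  attrStep S A v =
    A v
    ⊎ (S v × owner v ≡ false × ∃ λ v' → S v' × E v v' ≡ true × A v')
    ⊎ (S v × owner v ≡ true × (∀ v' → S v' → E v v' ≡ true → A v'))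

  attrIter : VSet n → VSet n → ℕ → VSet n
  attrIter S F zero = F
  attrIter S F (suc j) = attrStep S (attrIter S F j)

  Attr₀ : VSet n → VSet n → VSet n
  Attr₀ S F v = ∃ λ j → j ≤ n × attrIter S F j v

  costInfix : Play n → ℕ → ℕ → ℕ
  costInfix ρ k zero = 0
  costInfix ρ k (suc m) =
    costInfix ρ k m + (if Cst (ρ (k + m)) (ρ (suc (k + m))) then 1 else 0)

  Ans : ℕ → ℕ → Set
  Ans c c' = c ≤ c' × 2 ∣ c'

  Cor≤ : Play n → ℕ → ℕ → Set
  Cor≤ ρ k b = ∃ λ m → Ans (Ω (ρ k)) (Ω (ρ (k + m))) × costInfix ρ k m ≤ b

  CostParity : Play n → Set
  CostParity ρ = ∃ λ b → ∃ λ K → ∀ k → K ≤ k → Cor≤ ρ k b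

  -- request at k unanswered with cost ∞
  UnansweredInf : Play n → ℕ → Set
  UnansweredInf ρ k =
    (∀ m → ¬ Ans (Ω (ρ k)) (Ω (ρ (k + m))))
    × (∀ m → ∃ λ m' → m ≤ m' × Cst (ρ (k + m')) (ρ (suc (k + m'))) ≡ true)

  BndCostParity : Play n → Set
  BndCostParity ρ = CostParity ρ × ¬ (∃ λ k → UnansweredInf ρ k)

  -- The algorithm: arenaSeq j = A_j, X (suc j) = X_{j+1}, Wseq j = W₀^j
  arenaSeq : ℕ → VSet n
  X : ℕ → VSet n
  X zero = ∅
  X (suc j) = W₀ (arenaSeq j) BndCostParity
  arenaSeq zero = all
  arenaSeq (suc j) = arenaSeq j ∖ Attr₀ (arenaSeq j) (X (suc j))

  Wseq : ℕ → VSet n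
  Wseq zero = ∅
  Wseq (suc j) = Wseq j ∪ Attr₀ (arenaSeq j) (X (suc j))

-- Soundness: by induction on j every vertex of W₀^j wins CostParity in 𝒢. A vertex of X_j wins
-- BndCostParity ⊆ CostParity as long as the play stays in A_{j-1}, and a play leaving A_{j-1}
-- enters W₀^{j-1}; attractors of winning sets are winning. Both steps rest on CostParity being
-- prefix-independent: Player 0 may switch to a winning strategy on first entering a winning set.
-- Termination: every nonempty X_j deletes a vertex from the arena, so some X_j with j ≤ n + 1 is
-- empty.
-- Completeness: if X_j = ∅, Player 1 wins BndCostParity from every vertex of A_{j-1}, a set Player 0
-- cannot leave. Against a strategy σ of Player 0 that wins CostParity, Player 1 can then again and
-- again switch to a counterplay violating BndCostParity; since σ wins CostParity, each counterplay
-- contains a request that is never answered and whose cost grows unboundedly. Letting the s-th such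
-- request run up cost s before the next switch, the limit of these plays is consistent with σ but
-- has unbounded Cor, a contradiction.

module Submission where

open import Defs
open import Level using (0ℓ)
open import Axiom.ExcludedMiddle using (ExcludedMiddle)
open import Axiom.DoubleNegationElimination using (em⇒dne)
open import Data.Nat
  using (ℕ; zero; suc; _+_; _∸_; _≤_; _<_; _≤′_; ≤′-refl; ≤′-step; z≤n; s≤s; z<s; s<s; _≤?_)
open import Data.Nat.Properties
open import Data.Bool using (true; false; if_then_else_)
open import Data.Fin using (Fin; toℕ) renaming (_≟_ to _≟ᶠ_)
open import Data.Fin.Properties using (pigeonhole; toℕ<n)
open import Data.List using (List; []; _∷_; _++_; applyUpTo)
open import Data.List.Properties using (map-upTo)
open import Data.Maybe using (Maybe; just; nothing)
open import Data.Product using (Σ; ∃; _×_; _,_; proj₁; proj₂)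
open import Data.Sum using (_⊎_; inj₁; inj₂)
open import Data.Unit using (tt)
open import Data.Empty using (⊥-elim)
open import Function using (_∘_; id)
open import Function.Bundles using (_⇔_; mk⇔)
open import Relation.Nullary using (¬_; yes; no)
open import Relation.Unary using (Pred; Decidable; _⊆_; _∈_; _∉_; ∁)
open import Relation.Binary.PropositionalEquality
  using (_≡_; refl; sym; trans; cong; cong₂; subst; subst₂; module ≡-Reasoning)

least-witness : ∀ {p} (P : Pred ℕ p) → Decidable P → ∀ {k} → P k →
  ∃ λ t → P t × (∀ i → i < t → ¬ P i)
least-witness P P? {k} pk with P? 0
... | yes p0 = 0 , p0 , λ _ ()
least-witness P P? {zero} pk | no ¬p0 = ⊥-elim (¬p0 pk)
least-witness P P? {suc k} pk | no ¬p0 with least-witness (P ∘ suc) (P? ∘ suc) pk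
... | t , pt , below = suc t , pt , λ { zero _ → ¬p0 ; (suc i) (s<s i<t) → below i i<t }

chain-mono : ∀ {a ℓ} {A : Set a} (P : ℕ → Pred A ℓ) → (∀ {k} → P k ⊆ P (suc k)) →
  ∀ {k k′} → k ≤′ k′ → P k ⊆ P k′
chain-mono P step ≤′-refl = id
chain-mono P step (≤′-step k≤′k′) = step ∘ chain-mono P step k≤′k′

no-strictly-increasing-chain : ∀ {n ℓ} (P : ℕ → Pred (Fin n) ℓ) →
  (∀ {k} → P k ⊆ P (suc k)) → ¬ (∀ k → k ≤ n → ∃ λ v → v ∈ P (suc k) × v ∉ P k)
no-strictly-increasing-chain {n} P step new =
  let i , j , i<j , same = pigeonhole ≤-refl (proj₁ ∘ new′)
      i∈ = proj₁ (proj₂ (new′ i))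
  in proj₂ (proj₂ (new′ j)) (subst (P (toℕ j)) same (chain-mono P step (≤⇒≤′ i<j) i∈))
  where
  new′ : ∀ (k : Fin (suc n)) → ∃ λ v → v ∈ P (suc (toℕ k)) × v ∉ P (toℕ k)
  new′ k = new (toℕ k) (≤-pred (toℕ<n k))

applyUpTo-cong : ∀ {a} {A : Set a} {f g : ℕ → A} k → (∀ i → i < k → f i ≡ g i) →
  applyUpTo f k ≡ applyUpTo g k
applyUpTo-cong zero eq = refl
applyUpTo-cong (suc k) eq =
  cong₂ _∷_ (eq 0 z<s) (applyUpTo-cong k (λ i i<k → eq (suc i) (s<s i<k)))

data Split (m : ℕ) : ℕ → Set where
  before : ∀ {k} → k < m → Split m k
  after  : ∀ d → Split m (m + d)

split : ∀ m k → Split m k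
split zero k = after k
split (suc m) zero = before z<s
split (suc m) (suc k) with split m k
... | before k<m = before (s<s k<m)
... | after d = after d

module _ {n : ℕ} where

  Suffix : ℕ → Play n → Play n → Set
  Suffix m ρ ρ′ = ∀ i → ρ (m + i) ≡ ρ′ i

  -- ρ up to position m (exclusive), then ρ′
  splice : Play n → ℕ → Play n → Play n
  splice ρ zero ρ′ = ρ′
  splice ρ (suc m) ρ′ zero = ρ 0
  splice ρ (suc m) ρ′ (suc k) = splice (ρ ∘ suc) m ρ′ k

  splice-suffix : ∀ ρ m ρ′ → Suffix m (splice ρ m ρ′) ρ′
  splice-suffix ρ zero ρ′ i = refl
  splice-suffix ρ (suc m) ρ′ i = splice-suffix (ρ ∘ suc) m ρ′ i

  splice-prefix : ∀ ρ m ρ′ {k} → ρ′ 0 ≡ ρ m → k ≤ m → splice ρ m ρ′ k ≡ ρ k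
  splice-prefix ρ zero ρ′ {zero} joint _ = joint
  splice-prefix ρ (suc m) ρ′ {zero} joint _ = refl
  splice-prefix ρ (suc m) ρ′ {suc k} joint (s≤s k≤m) =
    splice-prefix (ρ ∘ suc) m ρ′ joint k≤m

  splice-applyUpTo : ∀ ρ m ρ′ d →
    applyUpTo (splice ρ m ρ′) (m + d) ≡ applyUpTo ρ m ++ applyUpTo ρ′ d
  splice-applyUpTo ρ zero ρ′ d = refl
  splice-applyUpTo ρ (suc m) ρ′ d = cong (ρ 0 ∷_) (splice-applyUpTo (ρ ∘ suc) m ρ′ d)

  module Limit (ρ : ℕ → Play n) (m : ℕ → ℕ) (m-grows : ∀ s → m s < m (suc s))
               (agree : ∀ s i → i ≤ m s → ρ (suc s) i ≡ ρ s i) where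

    limit : Play n
    limit t = ρ (suc t) t

    s≤m : ∀ s → s ≤ m s
    s≤m zero = z≤n
    s≤m (suc s) = ≤-trans (s≤s (s≤m s)) (m-grows s)

    m-mono : ∀ {s s′} → s ≤′ s′ → m s ≤ m s′
    m-mono ≤′-refl = ≤-refl
    m-mono (≤′-step s≤′s′) = ≤-trans (m-mono s≤′s′) (<⇒≤ (m-grows _))

    agree-later : ∀ {s s′ i} → s ≤′ s′ → i ≤ m s → ρ s′ i ≡ ρ s i
    agree-later ≤′-refl _ = refl
    agree-later (≤′-step s≤′s′) i≤ =
      trans (agree _ _ (≤-trans i≤ (m-mono s≤′s′))) (agree-later s≤′s′ i≤)

    limit-agrees : ∀ s {i} → i ≤ m s → limit i ≡ ρ s i
    limit-agrees s {i} i≤ with ≤-total s (suc i)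
    ... | inj₁ s≤ = agree-later (≤⇒≤′ s≤) i≤
    ... | inj₂ ≥s = sym (agree-later (≤⇒≤′ ≥s) (≤-trans (n≤1+n i) (s≤m (suc i))))

    limit-prefix : ∀ s {i} → i ≤ s → limit i ≡ ρ s i
    limit-prefix s i≤s = limit-agrees s (≤-trans i≤s (s≤m s))

module _ {n : ℕ} (G : CostParityGame n) where
  open CostParityGame G

  hist-cong : ∀ {ρ ρ′ : Play n} k → (∀ i → i < k → ρ i ≡ ρ′ i) →
    hist G ρ k ≡ hist G ρ′ k
  hist-cong {ρ} {ρ′} k eq = begin
    hist G ρ k     ≡⟨ map-upTo ρ k ⟩
    applyUpTo ρ k  ≡⟨ applyUpTo-cong k eq ⟩
    applyUpTo ρ′ k ≡⟨ map-upTo ρ′ k ⟨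
    hist G ρ′ k    ∎
    where open ≡-Reasoning

  hist-splice : ∀ ρ m ρ′ d → hist G (splice ρ m ρ′) (m + d) ≡ hist G ρ m ++ hist G ρ′ d
  hist-splice ρ m ρ′ d = begin
    hist G (splice ρ m ρ′) (m + d)       ≡⟨ map-upTo _ (m + d) ⟩
    applyUpTo (splice ρ m ρ′) (m + d)    ≡⟨ splice-applyUpTo ρ m ρ′ d ⟩
    applyUpTo ρ m ++ applyUpTo ρ′ d      ≡⟨ cong₂ _++_ (map-upTo ρ m) (map-upTo ρ′ d) ⟨
    hist G ρ m ++ hist G ρ′ d            ∎
    where open ≡-Reasoning

  costInfix-cong : ∀ {ρ ρ′ a a′} w → (∀ i → i ≤ w → ρ (a + i) ≡ ρ′ (a′ + i)) →
    costInfix G ρ a w ≡ costInfix G ρ′ a′ w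
  costInfix-cong zero eq = refl
  costInfix-cong {ρ} {ρ′} {a} {a′} (suc w) eq =
    cong₂ _+_ (costInfix-cong w (λ i i≤w → eq i (m≤n⇒m≤1+n i≤w)))
              (cong₂ (λ x y → if Cst x y then 1 else 0) (eq w (n≤1+n w)) next)
    where
    next : ρ (suc (a + w)) ≡ ρ′ (suc (a′ + w))
    next = trans (cong ρ (sym (+-suc a w))) (trans (eq (suc w) ≤-refl) (cong ρ′ (+-suc a′ w)))

  costInfix-mono : ∀ ρ k {w w′} → w ≤ w′ → costInfix G ρ k w ≤ costInfix G ρ k w′
  costInfix-mono ρ k {w′ = zero} z≤n = ≤-refl
  costInfix-mono ρ k {w′ = suc w′} w≤ with m≤n⇒m<n∨m≡n w≤
  ... | inj₁ (s≤s w≤w′) = ≤-trans (costInfix-mono ρ k w≤w′) (m≤m+n _ _)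
  ... | inj₂ refl = ≤-refl

  costInfix-unbounded : ∀ ρ k →
    (∀ m → ∃ λ m′ → m ≤ m′ × Cst (ρ (k + m′)) (ρ (suc (k + m′))) ≡ true) →
    ∀ c → ∃ λ w → c ≤ costInfix G ρ k w
  costInfix-unbounded ρ k increments zero = 0 , z≤n
  costInfix-unbounded ρ k increments (suc c) with costInfix-unbounded ρ k increments c
  ... | w , c≤ with increments w
  ... | m′ , w≤m′ , inc = suc m′ , (begin
    suc c                     ≡⟨ +-comm 1 c ⟩
    c + 1                     ≤⟨ +-monoˡ-≤ 1 (≤-trans c≤ (costInfix-mono ρ k w≤m′)) ⟩
    costInfix G ρ k m′ + 1    ≡⟨ cong (λ b → costInfix G ρ k m′ + (if b then 1 else 0)) inc ⟨
    costInfix G ρ k (suc m′)  ∎)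
    where open ≤-Reasoning

  Cor≤-transfer : ∀ {ρ ρ′ a a′ b} → (∀ i → ρ (a + i) ≡ ρ′ (a′ + i)) →
    Cor≤ G ρ a b → Cor≤ G ρ′ a′ b
  Cor≤-transfer {ρ} {ρ′} {a} {a′} eq (w , answer , cost≤) =
    w , subst₂ (Ans G) (cong Ω here) (cong Ω (eq w)) answer
      , subst (_≤ _) (costInfix-cong w (λ i _ → eq i)) cost≤
    where
    here : ρ a ≡ ρ′ a′
    here = subst₂ (λ x y → ρ x ≡ ρ′ y) (+-identityʳ a) (+-identityʳ a′) (eq 0)

  CostParity-suffix-closed : ∀ {m ρ ρ′} → Suffix m ρ ρ′ → CostParity G ρ → CostParity G ρ′
  CostParity-suffix-closed {m} {ρ} suffix (b , K , cor) =
    b , K , λ k K≤k → Cor≤-transfer (λ i → trans (cong ρ (+-assoc m k i)) (suffix (k + i)))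
                                     (cor (m + k) (≤-trans K≤k (m≤n+m k m)))

  CostParity-prefix-closed : ∀ {m ρ ρ′} → Suffix m ρ ρ′ → CostParity G ρ′ → CostParity G ρ
  CostParity-prefix-closed {m} {ρ} {ρ′} suffix (b , K , cor) =
    b , m + K , λ k m+K≤k → Cor≤-transfer (shift k (≤-trans (m≤m+n m K) m+K≤k))
      (cor (k ∸ m) (subst (_≤ k ∸ m) (m+n∸m≡n m K) (∸-monoˡ-≤ m m+K≤k)))
    where
    shift : ∀ k → m ≤ k → ∀ i → ρ′ (k ∸ m + i) ≡ ρ (k + i)
    shift k m≤k i = trans (sym (suffix (k ∸ m + i)))
      (cong ρ (trans (sym (+-assoc m (k ∸ m) i)) (cong (_+ i) (m+[n∸m]≡n m≤k))))

  -- Cor(ρ, p) > b, witnessed by the unanswered window ρ_p ⋯ ρ_{p+w}.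
  ExpensiveRequest : Play n → ℕ → ℕ → ℕ → Set
  ExpensiveRequest ρ p w b =
    (∀ w′ → w′ ≤ w → ¬ Ans G (Ω (ρ p)) (Ω (ρ (p + w′)))) × b < costInfix G ρ p w

  ExpensiveRequest⇒¬Cor≤ : ∀ {ρ p w b} → ExpensiveRequest ρ p w b → ¬ Cor≤ G ρ p b
  ExpensiveRequest⇒¬Cor≤ {ρ} {p} {w} (open′ , b<cost) (w′ , answer , cost≤b) with w′ ≤? w
  ... | yes w′≤w = open′ w′ w′≤w answer
  ... | no w′≰w = <⇒≱ b<cost (≤-trans (costInfix-mono ρ p (≰⇒≥ w′≰w)) cost≤b)

  ExpensiveRequest-transfer : ∀ {ρ ρ′ p p′ w b} →
    (∀ i → i ≤ w → ρ (p + i) ≡ ρ′ (p′ + i)) →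
    ExpensiveRequest ρ p w b → ExpensiveRequest ρ′ p′ w b
  ExpensiveRequest-transfer {ρ} {ρ′} {p} {p′} {w} eq (open′ , b<cost) =
    (λ w′ w′≤w answer →
       open′ w′ w′≤w (subst₂ (Ans G) (cong Ω (sym here)) (cong Ω (sym (eq w′ w′≤w))) answer))
    , subst (_ <_) (costInfix-cong w eq) b<cost
    where
    here : ρ p ≡ ρ′ p′
    here = subst₂ (λ x y → ρ x ≡ ρ′ y) (+-identityʳ p) (+-identityʳ p′) (eq 0 z≤n)

  UnansweredInf⇒ExpensiveRequest : ∀ {ρ p} → UnansweredInf G ρ p →
    ∀ b → ∃ λ w → ExpensiveRequest ρ p w b
  UnansweredInf⇒ExpensiveRequest {ρ} {p} (unanswered , increments) b =
    let w , cost = costInfix-unbounded ρ p increments (suc b)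
    in w , (λ w′ _ → unanswered w′) , cost

  module _ (S : VSet n) where

    attrStep-mono : ∀ {A B : VSet n} → A ⊆ B → attrStep G S A ⊆ attrStep G S B
    attrStep-mono A⊆B (inj₁ a) = inj₁ (A⊆B a)
    attrStep-mono A⊆B (inj₂ (inj₁ (s , o , v′ , s′ , e , a))) =
      inj₂ (inj₁ (s , o , v′ , s′ , e , A⊆B a))
    attrStep-mono A⊆B (inj₂ (inj₂ (s , o , all∈))) =
      inj₂ (inj₂ (s , o , λ v′ s′ e → A⊆B (all∈ v′ s′ e)))

    attrIter-mono : ∀ F {k k′} → k ≤ k′ → attrIter G S F k ⊆ attrIter G S F k′
    attrIter-mono F k≤k′ = chain-mono (attrIter G S F) inj₁ (≤⇒≤′ k≤k′)

    attrIter-stable : ∀ F {k} → attrIter G S F (suc k) ⊆ attrIter G S F k →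
      ∀ m → attrIter G S F (m + k) ⊆ attrIter G S F k
    attrIter-stable F stable zero = id
    attrIter-stable F stable (suc m) = stable ∘ attrStep-mono (attrIter-stable F stable m)

  X-removed : ∀ k {x} → X G (suc k) x → x ∈ ∁ (arenaSeq G (suc k)) × x ∉ ∁ (arenaSeq G k)
  X-removed k x∈X = (λ (_ , ∉attr) → ∉attr (0 , z≤n , x∈X)) , λ x∉ → x∉ (proj₁ x∈X)

  Strategy₀ : Set
  Strategy₀ = Strategy G (all G) false

  WinningRegion : (Play n → Set) → VSet n
  WinningRegion Win = W₀ G (all G) Win

  WinsFrom : (Play n → Set) → Strategy₀ → Fin n → Set
  WinsFrom Win σ v = ∀ ρ → IsPlayIn G (all G) ρ → ρ 0 ≡ v → Consistent G σ ρ → Win ρ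

  PrefixClosed : (Play n → Set) → Set
  PrefixClosed Win = ∀ {m ρ ρ′} → Suffix m ρ ρ′ → Win ρ′ → Win ρ

  Player0Closed : VSet n → Set
  Player0Closed A = ∀ {y y′} → A y → owner y ≡ false → E y y′ ≡ true → A y′

  arbitraryStrategy : Strategy₀
  arbitraryStrategy = (λ _ y → proj₁ (total y)) , λ _ y _ _ → tt , proj₂ (total y)

  moveTo : ∀ v v′ → E v v′ ≡ true → Strategy₀
  moveTo v v′ e = choice , legal
    where
    choice : List (Fin n) → Fin n → Fin n
    choice _ y with y ≟ᶠ v
    ... | yes _ = v′
    ... | no _ = proj₁ (total y)
    legal : ∀ w y → all G y → owner y ≡ false → all G (choice w y) × E y (choice w y) ≡ true
    legal _ y _ _ with y ≟ᶠ v
    ... | yes refl = tt , e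
    ... | no _ = tt , proj₂ (total y)

  moveTo-moves : ∀ {v v′} (e : E v v′ ≡ true) w → proj₁ (moveTo v v′ e) w v ≡ v′
  moveTo-moves {v} e w with v ≟ᶠ v
  ... | yes _ = refl
  ... | no v≢v = ⊥-elim (v≢v refl)

  extendStrategy : ∀ {A : VSet n} → Decidable A → Strategy G A false → Strategy₀
  extendStrategy {A} A? (τ , τ-legal) = choice , legal
    where
    choice : List (Fin n) → Fin n → Fin n
    choice w y with A? y
    ... | yes _ = τ w y
    ... | no _ = proj₁ (total y)
    legal : ∀ w y → all G y → owner y ≡ false → all G (choice w y) × E y (choice w y) ≡ true
    legal w y _ o with A? y
    ... | yes a = tt , proj₂ (τ-legal w y a o)
    ... | no _ = tt , proj₂ (total y)

  extendStrategy-agrees : ∀ {A : VSet n} (A? : Decidable A) (τ : Strategy G A false) {w y} → A y →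
    proj₁ (extendStrategy A? τ) w y ≡ proj₁ τ w y
  extendStrategy-agrees A? τ {y = y} a with A? y
  ... | yes _ = refl
  ... | no a∉ = ⊥-elim (a∉ a)

  -- Follow σ until the play first enters T, then the strategy τ x of the entry vertex x,
  -- fed with the history since the entry.
  module Switching {T : VSet n} (T? : Decidable T) (τ : Fin n → Strategy₀) (σ : Strategy₀) where

    firstVisit : List (Fin n) → Maybe (Fin n × List (Fin n))
    firstVisit [] = nothing
    firstVisit (x ∷ w) with T? x
    ... | yes _ = just (x , x ∷ w)
    ... | no _ = firstVisit w

    active : List (Fin n) → Fin n → Strategy₀ × List (Fin n)
    active w y with firstVisit w
    ... | just (x , s) = τ x , s
    ... | nothing with T? y
    ...   | yes _ = τ y , []
    ...   | no _ = σ , w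

    move : Strategy₀ × List (Fin n) → Fin n → Fin n
    move (τ′ , h) y = proj₁ τ′ h y

    switching : Strategy₀
    switching = (λ w y → move (active w y) y) ,
                λ w y _ o → proj₂ (proj₁ (active w y)) (proj₂ (active w y)) y tt o

    firstVisit-none : ∀ ρ k → (∀ i → i < k → ¬ T (ρ i)) →
      firstVisit (applyUpTo ρ k) ≡ nothing
    firstVisit-none ρ zero never = refl
    firstVisit-none ρ (suc k) never with T? (ρ 0)
    ... | yes t = ⊥-elim (never 0 z<s t)
    ... | no _ = firstVisit-none (ρ ∘ suc) k (λ i i<k → never (suc i) (s<s i<k))

    firstVisit-first : ∀ ρ t k → (∀ i → i < t → ¬ T (ρ i)) → T (ρ t) →
      firstVisit (applyUpTo ρ (t + suc k)) ≡ just (ρ t , applyUpTo (λ i → ρ (t + i)) (suc k))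
    firstVisit-first ρ zero k _ at with T? (ρ 0)
    ... | yes _ = refl
    ... | no ¬at = ⊥-elim (¬at at)
    firstVisit-first ρ (suc t) k earlier at with T? (ρ 0)
    ... | yes t0 = ⊥-elim (earlier 0 z<s t0)
    ... | no _ = firstVisit-first (ρ ∘ suc) t k (λ i i<t → earlier (suc i) (s<s i<t)) at

    active-unswitched : ∀ {w y} → firstVisit w ≡ nothing → ¬ T y → active w y ≡ (σ , w)
    active-unswitched {w} {y} none ¬ty rewrite none with T? y
    ... | yes ty = ⊥-elim (¬ty ty)
    ... | no _ = refl

    active-entering : ∀ {w y} → firstVisit w ≡ nothing → T y → active w y ≡ (τ y , [])
    active-entering {w} {y} none ty rewrite none with T? y
    ... | yes _ = refl
    ... | no ¬ty = ⊥-elim (¬ty ty)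

    active-switched : ∀ {w y x s} → firstVisit w ≡ just (x , s) → active w y ≡ (τ x , s)
    active-switched first rewrite first = refl

    follows : ∀ {ρ k τ′ h} → Consistent G switching ρ → owner (ρ k) ≡ false →
      active (hist G ρ k) (ρ k) ≡ (τ′ , h) → ρ (suc k) ≡ proj₁ τ′ h (ρ k)
    follows {ρ} {k} consistent o eq = trans (consistent k o) (cong (λ a → move a (ρ k)) eq)

    unswitched : ∀ {ρ} → Consistent G switching ρ → (∀ k → ¬ T (ρ k)) → Consistent G σ ρ
    unswitched {ρ} consistent never k o =
      follows consistent o (active-unswitched {hist G ρ k} none (never k))
      where
      none : firstVisit (hist G ρ k) ≡ nothing
      none = trans (cong firstVisit (map-upTo ρ k)) (firstVisit-none ρ k (λ i _ → never i))

    switched : ∀ {ρ t} → Consistent G switching ρ → (∀ i → i < t → ¬ T (ρ i)) → T (ρ t) →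
      Consistent G (τ (ρ t)) (λ i → ρ (t + i))
    switched {ρ} {t} consistent earlier at k o =
      trans (cong ρ (+-suc t k)) (follows consistent o (active-after k))
      where
      active-after : ∀ k →
        active (hist G ρ (t + k)) (ρ (t + k)) ≡ (τ (ρ t) , hist G (λ i → ρ (t + i)) k)
      active-after zero rewrite +-identityʳ t = active-entering {hist G ρ t}
        (trans (cong firstVisit (map-upTo ρ t)) (firstVisit-none ρ t earlier)) at
      active-after (suc k) = active-switched {hist G ρ (t + suc k)} (begin
        firstVisit (hist G ρ (t + suc k))                 ≡⟨ cong firstVisit (map-upTo ρ (t + suc k)) ⟩
        firstVisit (applyUpTo ρ (t + suc k))              ≡⟨ firstVisit-first ρ t k earlier at ⟩
        just (ρ t , applyUpTo (λ i → ρ (t + i)) (suc k))  ≡⟨ cong (just ∘ (ρ t ,_)) (map-upTo _ (suc k)) ⟨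
        just (ρ t , hist G (λ i → ρ (t + i)) (suc k))     ∎)
        where open ≡-Reasoning

module _ (em : ExcludedMiddle 0ℓ) {n : ℕ} (G : CostParityGame n) where
  open CostParityGame G

  private
    dne : ∀ {P : Set} → ¬ ¬ P → P
    dne = em⇒dne em

  attrIter-saturated : ∀ S F → attrIter G S F (suc n) ⊆ Attr₀ G S F
  attrIter-saturated S F {v} x with em {∃ λ k → k ≤ n × attrIter G S F (suc k) ⊆ attrIter G S F k}
  ... | yes (k , k≤n , stable) = k , k≤n , attrIter-stable G S F stable (suc n ∸ k)
          (subst (λ j → attrIter G S F j v) (sym (m∸n+n≡m (m≤n⇒m≤1+n k≤n))) x)
  ... | no never-stable = ⊥-elim (no-strictly-increasing-chain (attrIter G S F) inj₁ grows)
    where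
    grows : ∀ k → k ≤ n → ∃ λ v → v ∈ attrIter G S F (suc k) × v ∉ attrIter G S F k
    grows k k≤n = dne λ none →
      never-stable (k , k≤n , λ {v} x → dne λ x∉ → none (v , x , x∉))

  Attr₀-closed : ∀ S F → attrStep G S (Attr₀ G S F) ⊆ Attr₀ G S F
  Attr₀-closed S F =
    attrIter-saturated S F ∘ attrStep-mono G S (λ (j , j≤n , x) → attrIter-mono G S F j≤n x)

  arenaSeq-closed : ∀ i → Player0Closed G (arenaSeq G i)
  arenaSeq-closed zero _ _ _ = tt
  arenaSeq-closed (suc i) (a , ∉attr) o e =
    a′ , λ attr′ →
      ∉attr (Attr₀-closed (arenaSeq G i) (X G (suc i)) (inj₂ (inj₁ (a , o , _ , a′ , e , attr′))))
    where
    a′ : arenaSeq G i _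
    a′ = arenaSeq-closed i a o e

  arenaSeq-or-Wseq : ∀ i v → arenaSeq G i v ⊎ Wseq G i v
  arenaSeq-or-Wseq zero v = inj₁ tt
  arenaSeq-or-Wseq (suc i) v with arenaSeq-or-Wseq i v
  ... | inj₂ w = inj₂ (inj₁ w)
  ... | inj₁ a with em {Attr₀ G (arenaSeq G i) (X G (suc i)) v}
  ...   | yes attr = inj₂ (inj₂ attr)
  ...   | no ∉attr = inj₁ (a , ∉attr)

  algorithm-halts : ∃ λ k → k ≤ n × ¬ ∃ (X G (suc k))
  algorithm-halts = dne λ never →
    no-strictly-increasing-chain (λ k → ∁ (arenaSeq G k)) (λ {k} x∉ x∈ → x∉ (proj₁ x∈))
      λ k k≤n → dne λ none-removed →
        never (k , k≤n , λ (x , x∈X) → none-removed (x , X-removed G k x∈X))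

  halting-round : ∃ λ t → t ≤ n × ¬ ∃ (X G (suc t)) × (∀ i → i < t → ∃ (X G (suc i)))
  halting-round with algorithm-halts
  ... | k , k≤n , empty with least-witness (λ i → ¬ ∃ (X G (suc i))) (λ _ → em) {k} empty
  ... | t , empty-t , earlier =
    t , ≤-trans (≮⇒≥ (λ k<t → earlier k k<t empty)) k≤n , empty-t ,
    λ i i<t → dne (earlier i i<t)

  strategy-choice : ∀ {Win : Play n → Set} {T : VSet n} → T ⊆ WinningRegion G Win →
    ∀ x → Σ (Strategy₀ G) λ τ → T x → WinsFrom G Win τ x
  strategy-choice {T = T} T⊆ x with em {T x}
  ... | yes x∈T = let _ , τ , wins = T⊆ x∈T in τ , λ _ → wins
  ... | no x∉T = arbitraryStrategy G , λ x∈T → ⊥-elim (x∉T x∈T)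

  module _ {Win : Play n → Set} (prefix-closed : PrefixClosed G Win) where

    winning-by-reaching : ∀ {T : VSet n} {v} → T ⊆ WinningRegion G Win → (σ : Strategy₀ G) →
      WinsFrom G (λ ρ → Win ρ ⊎ ∃ λ k → T (ρ k)) σ v → WinningRegion G Win v
    winning-by-reaching {T} {v} T⊆ σ wins-or-reaches = tt , switching , wins
      where
      choice : ∀ x → Σ (Strategy₀ G) λ τ → T x → WinsFrom G Win τ x
      choice = strategy-choice T⊆
      open Switching G {T} (λ _ → em) (proj₁ ∘ choice) σ
      wins : WinsFrom G Win switching v
      wins ρ play start consistent with em {∃ λ k → T (ρ k)}
      ... | no never
          with wins-or-reaches ρ play start (unswitched consistent (λ k visit → never (k , visit)))
      ...   | inj₁ win = win
      ...   | inj₂ reach = ⊥-elim (never reach)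
      wins ρ play start consistent | yes (k , visit)
          with least-witness (λ i → T (ρ i)) (λ _ → em) visit
      ... | t , at , earlier =
        prefix-closed (λ _ → refl) (proj₂ (choice (ρ t)) at (λ i → ρ (t + i)) suffix-play
                                      (cong ρ (+-identityʳ t)) (switched consistent earlier at))
        where
        suffix-play : IsPlayIn G (all G) (λ i → ρ (t + i))
        suffix-play = (λ _ → tt) , λ i →
          subst (λ j → E (ρ (t + i)) (ρ j) ≡ true) (sym (+-suc t i)) (proj₂ play (t + i))

    attrIter-winning : ∀ {S F : VSet n} → F ⊆ WinningRegion G Win → ∁ S ⊆ WinningRegion G Win →
      ∀ r → attrIter G S F r ⊆ WinningRegion G Win
    attrIter-winning F⊆ ∁S⊆ zero = F⊆
    attrIter-winning F⊆ ∁S⊆ (suc r) (inj₁ x) = attrIter-winning F⊆ ∁S⊆ r x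
    attrIter-winning {S} {F} F⊆ ∁S⊆ (suc r) {v} (inj₂ (inj₁ (_ , o , v′ , _ , e , x′))) =
      winning-by-reaching (attrIter-winning F⊆ ∁S⊆ r) (moveTo G v v′ e)
        λ ρ _ start consistent →
          inj₂ (1 , subst (attrIter G S F r) (sym (moves ρ start consistent)) x′)
      where
      moves : ∀ ρ → ρ 0 ≡ v → Consistent G (moveTo G v v′ e) ρ → ρ 1 ≡ v′
      moves ρ start consistent =
        trans (consistent 0 (subst (λ y → owner y ≡ false) (sym start) o))
              (trans (cong (proj₁ (moveTo G v v′ e) []) start) (moveTo-moves G e []))
    attrIter-winning {S} {F} F⊆ ∁S⊆ (suc r) {v} (inj₂ (inj₂ (_ , _ , all∈))) =
      winning-by-reaching {T = λ y → attrIter G S F r y ⊎ y ∉ S} target⊆ (arbitraryStrategy G)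
        λ ρ play start _ →
          inj₂ (1 , successor (subst (λ y → E y (ρ 1) ≡ true) start (proj₂ play 0)))
      where
      target⊆ : (λ y → attrIter G S F r y ⊎ y ∉ S) ⊆ WinningRegion G Win
      target⊆ (inj₁ x) = attrIter-winning F⊆ ∁S⊆ r x
      target⊆ (inj₂ s∉) = ∁S⊆ s∉
      successor : ∀ {y} → E v y ≡ true → attrIter G S F r y ⊎ y ∉ S
      successor {y} e with em {S y}
      ... | yes s = inj₁ (all∈ y s e)
      ... | no s∉ = inj₂ s∉

    subarena-winning : ∀ {A : VSet n} {Win′ : Play n → Set} →
      Win′ ⊆ Win → ∁ A ⊆ WinningRegion G Win → W₀ G A Win′ ⊆ WinningRegion G Win
    subarena-winning {A} Win′⊆ ∁A⊆ {v} (_ , τ , τ-wins) =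
      winning-by-reaching ∁A⊆ (extendStrategy G (λ _ → em) τ) wins-or-leaves
      where
      wins-or-leaves : WinsFrom G (λ ρ → Win ρ ⊎ ∃ λ k → ρ k ∉ A) (extendStrategy G (λ _ → em) τ) v
      wins-or-leaves ρ play start consistent with em {∃ λ k → ρ k ∉ A}
      ... | yes leaves = inj₂ leaves
      ... | no stays = inj₁ (Win′⊆ (τ-wins ρ (stays-in , proj₂ play) start λ k o →
              trans (consistent k o) (extendStrategy-agrees G (λ _ → em) τ (stays-in k))))
        where
        stays-in : ∀ k → A (ρ k)
        stays-in k = dne λ k∉ → stays (k , k∉)

  Wseq-sound : ∀ i → Wseq G i ⊆ WinningRegion G (CostParity G)
  Wseq-sound (suc i) (inj₁ w) = Wseq-sound i w
  Wseq-sound (suc i) (inj₂ (r , _ , x)) =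
    attrIter-winning (CostParity-prefix-closed G)
      (subarena-winning (CostParity-prefix-closed G) proj₁ outside) outside r x
    where
    outside : ∁ (arenaSeq G i) ⊆ WinningRegion G (CostParity G)
    outside {v} a∉ with arenaSeq-or-Wseq i v
    ... | inj₁ a = ⊥-elim (a∉ a)
    ... | inj₂ w = Wseq-sound i w

  module Refute {A : VSet n} (closed : Player0Closed G A)
                (A-lost : ∀ x → ¬ W₀ G A (BndCostParity G) x) {u : Fin n} (u∈A : A u)
                (σ : Strategy₀ G) (σ-wins : WinsFrom G (CostParity G) σ u) where

    σ-after : List (Fin n) → Strategy G A false
    σ-after h = (λ w y → proj₁ σ (h ++ w) y) ,
                λ w y a o → let _ , e = proj₂ σ (h ++ w) y tt o in closed a o e , e

    counterplay : ∀ h {x} → A x →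
      ∃ λ ρ → IsPlayIn G A ρ × ρ 0 ≡ x × Consistent G (σ-after h) ρ × ¬ BndCostParity G ρ
    counterplay h {x} x∈A = dne λ none →
      A-lost x (x∈A , σ-after h , λ ρ ρ-in-A start consistent → dne λ ¬bounded →
        none (ρ , ρ-in-A , start , consistent , ¬bounded))

    record Run : Set where
      field
        play : Play n
        in-A : IsPlayIn G A play
        start : play 0 ≡ u
        consistent : Consistent G σ play
    open Run

    initial : Run
    initial = let ρ , ρ-in-A , start , consistent , _ = counterplay [] u∈A in
      record { play = ρ ; in-A = ρ-in-A ; start = start ; consistent = consistent }

    splice-run : (r : Run) (m : ℕ) (ρ′ : Play n) → IsPlayIn G A ρ′ → ρ′ 0 ≡ play r m →
      Consistent G (σ-after (hist G (play r) m)) ρ′ → Run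
    splice-run r m ρ′ ρ′-in-A joint ρ′-consistent = record
      { play = ρ″ ; in-A = vertices , edges ; start = trans (low z≤n) (start r)
      ; consistent = consistent″ }
      where
      ρ″ : Play n
      ρ″ = splice (play r) m ρ′
      low : ∀ {k} → k ≤ m → ρ″ k ≡ play r k
      low = splice-prefix (play r) m ρ′ joint
      high : Suffix m ρ″ ρ′
      high = splice-suffix (play r) m ρ′
      high-suc : ∀ d → ρ″ (suc (m + d)) ≡ ρ′ (suc d)
      high-suc d = trans (cong ρ″ (sym (+-suc m d))) (high (suc d))
      vertices : ∀ k → A (ρ″ k)
      vertices k with split m k
      ... | before k<m = subst A (sym (low (<⇒≤ k<m))) (proj₁ (in-A r) k)
      ... | after d = subst A (sym (high d)) (proj₁ ρ′-in-A d)
      edges : ∀ k → E (ρ″ k) (ρ″ (suc k)) ≡ true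
      edges k with split m k
      ... | before k<m = subst₂ (λ y y′ → E y y′ ≡ true) (sym (low (<⇒≤ k<m))) (sym (low k<m))
                           (proj₂ (in-A r) k)
      ... | after d = subst₂ (λ y y′ → E y y′ ≡ true) (sym (high d)) (sym (high-suc d))
                        (proj₂ ρ′-in-A d)
      consistent″ : Consistent G σ ρ″
      consistent″ k o with split m k
      ... | before k<m = begin
        ρ″ (suc k)                              ≡⟨ low k<m ⟩
        play r (suc k)                          ≡⟨ consistent r k (subst (λ y → owner y ≡ false) same o) ⟩
        proj₁ σ (hist G (play r) k) (play r k)  ≡⟨ cong₂ (proj₁ σ) same-history same ⟨
        proj₁ σ (hist G ρ″ k) (ρ″ k)            ∎
        where
        open ≡-Reasoning
        same : ρ″ k ≡ play r k
        same = low (<⇒≤ k<m)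
        same-history : hist G ρ″ k ≡ hist G (play r) k
        same-history = hist-cong G k (λ i i<k → low (<⇒≤ (<-trans i<k k<m)))
      ... | after d = begin
        ρ″ (suc (m + d))                                   ≡⟨ high-suc d ⟩
        ρ′ (suc d)                                         ≡⟨ ρ′-consistent d (subst (λ y → owner y ≡ false) (high d) o) ⟩
        proj₁ σ (hist G (play r) m ++ hist G ρ′ d) (ρ′ d)  ≡⟨ cong₂ (proj₁ σ) history (high d) ⟨
        proj₁ σ (hist G ρ″ (m + d)) (ρ″ (m + d))           ∎
        where
        open ≡-Reasoning
        history : hist G ρ″ (m + d) ≡ hist G (play r) m ++ hist G ρ′ d
        history = hist-splice G (play r) m ρ′ d

    record Extension (r : Run) (m c : ℕ) : Set where
      field
        next : Run
        agrees : ∀ {i} → i ≤ m → play next i ≡ play r i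
        pos window : ℕ
        m≤pos : m ≤ pos
        expensive : ExpensiveRequest G (play next) pos window c

    extend : ∀ r m c → Extension r m c
    extend r m c = extension (counterplay (hist G (play r) m) (proj₁ (in-A r) m))
      where
      extension : (∃ λ ρ′ → IsPlayIn G A ρ′ × ρ′ 0 ≡ play r m
                      × Consistent G (σ-after (hist G (play r) m)) ρ′ × ¬ BndCostParity G ρ′) →
                  Extension r m c
      extension (ρ′ , ρ′-in-A , joint , ρ′-consistent , ¬bounded) = record
        { next = r′ ; agrees = splice-prefix (play r) m ρ′ joint
        ; pos = m + k ; window = proj₁ expensive′ ; m≤pos = m≤m+n m k
        ; expensive = ExpensiveRequest-transfer G shift (proj₂ expensive′) }
        where
        r′ : Run
        r′ = splice-run r m ρ′ ρ′-in-A joint ρ′-consistent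
        unanswered : ∃ (UnansweredInf G ρ′)
        unanswered = dne λ none → ¬bounded
          (CostParity-suffix-closed G (splice-suffix (play r) m ρ′)
             (σ-wins (play r′) ((λ _ → tt) , proj₂ (in-A r′)) (start r′) (consistent r′)) , none)
        k : ℕ
        k = proj₁ unanswered
        expensive′ : ∃ λ w → ExpensiveRequest G ρ′ k w c
        expensive′ = UnansweredInf⇒ExpensiveRequest G (proj₂ unanswered) c
        shift : ∀ i → i ≤ proj₁ expensive′ → ρ′ (k + i) ≡ play r′ (m + k + i)
        shift i _ =
          sym (trans (cong (play r′) (+-assoc m k i)) (splice-suffix (play r) m ρ′ (k + i)))

    stage : ℕ → Run × ℕ
    extension : ∀ s → Extension (proj₁ (stage s)) (proj₂ (stage s)) s
    stage zero = initial , 0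
    stage (suc s) = let open Extension (extension s) in next , suc (pos + window)
    extension s = extend (proj₁ (stage s)) (proj₂ (stage s)) s

    open Limit (play ∘ proj₁ ∘ stage) (proj₂ ∘ stage)
               (λ s → s≤s (≤-trans (Extension.m≤pos (extension s)) (m≤m+n _ _)))
               (λ s i → Extension.agrees (extension s)) public

    limit-play : IsPlayIn G (all G) limit
    limit-play = (λ _ → tt) , λ t →
      subst₂ (λ y y′ → E y y′ ≡ true)
             (sym (limit-prefix (suc t) (n≤1+n t))) (sym (limit-prefix (suc t) ≤-refl))
             (proj₂ (in-A (proj₁ (stage (suc t)))) t)

    limit-start : limit 0 ≡ u
    limit-start = start (proj₁ (stage 1))

    limit-consistent : Consistent G σ limit
    limit-consistent t o = begin
      limit (suc t)                       ≡⟨ limit-prefix (suc t) ≤-refl ⟩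
      ρ (suc t)                           ≡⟨ consistent r t (subst (λ y → owner y ≡ false) same o) ⟩
      proj₁ σ (hist G ρ t) (ρ t)          ≡⟨ cong₂ (proj₁ σ) same-history same ⟨
      proj₁ σ (hist G limit t) (limit t)  ∎
      where
      open ≡-Reasoning
      r : Run
      r = proj₁ (stage (suc t))
      ρ : Play n
      ρ = play r
      same : limit t ≡ ρ t
      same = limit-prefix (suc t) (n≤1+n t)
      same-history : hist G limit t ≡ hist G ρ t
      same-history = hist-cong G t (λ i i<t → limit-prefix (suc t) (≤-trans (<⇒≤ i<t) (n≤1+n t)))

    limit-loses : ¬ CostParity G limit
    limit-loses (b , K , cor) = ExpensiveRequest⇒¬Cor≤ G expensive-in-limit (weaken (cor pos K≤pos))
      where
      open Extension (extension (K + b))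
      K≤pos : K ≤ pos
      K≤pos = ≤-trans (m≤m+n K b) (≤-trans (s≤m (K + b)) m≤pos)
      weaken : Cor≤ G limit pos b → Cor≤ G limit pos (K + b)
      weaken (w′ , answer , cost≤b) = w′ , answer , ≤-trans cost≤b (m≤n+m b K)
      expensive-in-limit : ExpensiveRequest G limit pos window (K + b)
      expensive-in-limit = ExpensiveRequest-transfer G
        (λ i i≤w → sym (limit-agrees (suc (K + b)) (m≤n⇒m≤1+n (+-monoʳ-≤ pos i≤w)))) expensive

  closed-subarena-lost : ∀ {A : VSet n} → Player0Closed G A →
    (∀ x → ¬ W₀ G A (BndCostParity G) x) → ∀ {u} → A u → ¬ WinningRegion G (CostParity G) u
  closed-subarena-lost closed A-lost u∈A (_ , σ , σ-wins) =
    limit-loses (σ-wins limit limit-play limit-start limit-consistent)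
    where open Refute closed A-lost u∈A σ σ-wins

  Wseq-complete : ∀ t → ¬ ∃ (X G (suc t)) → WinningRegion G (CostParity G) ⊆ Wseq G (suc t)
  Wseq-complete t empty {v} win with arenaSeq-or-Wseq t v
  ... | inj₂ w = inj₁ w
  ... | inj₁ a =
    ⊥-elim (closed-subarena-lost (arenaSeq-closed t) (λ x x∈X → empty (x , x∈X)) a win)

lemma4p3 : ExcludedMiddle 0ℓ → ∀ {n} (G : CostParityGame n) →
    ∃ λ j → 1 ≤ j × j ≤ suc n
    × (∀ j' → 1 ≤ j' → j' < j → ∃ λ v → X G j' v)
    × (∀ v → ¬ X G j v)
    × (∀ v → Wseq G j v ⇔ W₀ G (all G) (CostParity G) v)
lemma4p3 em G with halting-round em G
... | t , t≤n , empty , earlier =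
  suc t , s≤s z≤n , s≤s t≤n , nonempty , (λ v x → empty (v , x)) ,
  λ v → mk⇔ (Wseq-sound em G (suc t)) (Wseq-complete em G t empty)
  where
  nonempty : ∀ j → 1 ≤ j → j < suc t → ∃ (X G j)
  nonempty (suc i) _ (s≤s i<t) = earlier i i<t
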